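{- In a saturated pure partial plane of order $n$, no point lies on exactly $n$ lines.
   Context: A pure partial plane of order $n$ and size $s$ is a set $X$ of $n^2+n+1$ points together with a collection of $s$ distinct lines, each line being a subset of $X$ of cardinality $n+1$, such that any two distinct lines intersect in exactly one point. It is saturated if no further $(n+1)$-subset of $X$ can be added as a new line so that the result is still a pure partial plane (i.e. no $(n+1)$-subset of $X$ other than the existing lines meets every existing line in exactly one point). -}

module Defs where

open import Data.Nat using (ℕ; suc; _+_; _*_)
open import Data.Fin using (Fin)
open import Data.Fin.Subset using (Subset; _∩_; ∣_∣; _∈_)
open import Data.Fin.Subset.Properties using (_∈?_)
open import Data.List using (List; length; filter)
open import Data.List.Relation.Unary.Unique.Propositional using (Unique)
open import Data.List.Relation.Unary.All using (All)
open import Data.List.Membership.Propositional renaming (_∈_ to _∈ₗ_)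
open import Relation.Binary.PropositionalEquality using (_≡_; _≢_)

numPoints : ℕ → ℕ
numPoints n = n * n + n + 1

Point : ℕ → Set
Point n = Fin (numPoints n)

Line : ℕ → Set
Line n = Subset (numPoints n)

record PurePartialPlane (n : ℕ) : Set where
  field
    lines    : List (Line n)
    distinct : Unique lines
    lineSize : All (λ L → ∣ L ∣ ≡ suc n) lines
    meetOnce : ∀ {L M} → L ∈ₗ lines → M ∈ₗ lines → L ≢ M → ∣ L ∩ M ∣ ≡ 1

open PurePartialPlane public

-- saturated: every (n+1)-subset meeting each line in exactly one point
-- (i.e. that could be added keeping the axioms) is already a line.
Saturated : {n : ℕ} → PurePartialPlane n → Set
Saturated {n} P =
  ∀ (S : Line n) → ∣ S ∣ ≡ suc n →
  (∀ {L} → L ∈ₗ lines P → ∣ S ∩ L ∣ ≡ 1) → S ∈ₗ lines P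

degree : {n : ℕ} → PurePartialPlane n → Point n → ℕ
degree P x = length (filter (x ∈?_) (lines P))

-- If x lies on exactly n lines, these pairwise meet only in x, so together they cover
-- 1 + n·n points; the n uncovered points together with x form an (n+1)-set T.  T meets a
-- line through x only in x, and a line L avoiding x in exactly one point, because L meets
-- the n lines through x in n distinct points.  By saturation T is a line through x, so it
-- meets itself only in x: then n = 0, yet T is one of the n lines through x.
module Submission where

open import Defs
open import Data.Nat using (ℕ; suc; _+_; _*_; _∸_)
open import Data.Nat.Properties
  using (suc-injective; 0≢1+n; +-suc; +-comm; +-assoc; +-cancelˡ-≡; *-identityʳ; m+n∸m≡n)
open import Data.Fin using (Fin; zero; suc)
open import Data.Fin.Properties using (_≟_; ¬Fin0)
open import Data.Fin.Subset
  using (Subset; inside; outside; _∩_; _∪_; ∁; ⁅_⁆; ⊤; ⋃; _-_; _⊆_; _∉_; Empty; ∣_∣)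
  renaming (_∈_ to _∈ˢ_)
open import Data.Fin.Subset.Properties
open import Data.Vec using ([]; _∷_)
open import Data.Vec.Base using (module _[_]=_)
open _[_]=_ using () renaming (here to hereᵥ)
open import Data.List using (List; []; _∷_; length; map; filter)
open import Data.List.Properties using (length-map)
open import Data.List.Membership.Propositional using (_∈_)
open import Data.List.Membership.Propositional.Properties using (∈-map⁺; ∈-filter⁺; ∈-filter⁻)
open import Data.List.Relation.Unary.Any as Any using (Any; here; there)
open import Data.List.Relation.Unary.Any.Properties as Anyₚ using ()
open import Data.List.Relation.Unary.All as All using (All; _∷_)
open import Data.List.Relation.Unary.All.Properties as Allₚ using ()
open import Data.List.Relation.Unary.AllPairs using (AllPairs; []; _∷_)
open import Data.List.Relation.Unary.AllPairs.Properties as AllPairsₚ using ()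
open import Data.List.Relation.Unary.Unique.Propositional using (Unique)
open import Data.List.Relation.Unary.Unique.Propositional.Properties as Uniqueₚ using ()
open import Data.Product using (_×_; _,_)
open import Data.Sum using (inj₁; inj₂)
open import Data.Empty using (⊥-elim)
open import Relation.Nullary using (yes; no)
open import Relation.Binary.PropositionalEquality

private
  variable
    m : ℕ

Disjoint : Subset m → Subset m → Set
Disjoint p q = Empty (p ∩ q)

∣p∪q∣≡∣p∣+∣q∣ : ∀ (p q : Subset m) → Disjoint p q → ∣ p ∪ q ∣ ≡ ∣ p ∣ + ∣ q ∣
∣p∪q∣≡∣p∣+∣q∣ []            []            _ = refl
∣p∪q∣≡∣p∣+∣q∣ (inside ∷ p)  (inside ∷ q)  d = ⊥-elim (d (zero , hereᵥ))
∣p∪q∣≡∣p∣+∣q∣ (inside ∷ p)  (outside ∷ q) d = cong suc (∣p∪q∣≡∣p∣+∣q∣ p q (drop-∷-Empty d))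
∣p∪q∣≡∣p∣+∣q∣ (outside ∷ p) (inside ∷ q)  d =
  trans (cong suc (∣p∪q∣≡∣p∣+∣q∣ p q (drop-∷-Empty d))) (sym (+-suc ∣ p ∣ ∣ q ∣))
∣p∪q∣≡∣p∣+∣q∣ (outside ∷ p) (outside ∷ q) d = ∣p∪q∣≡∣p∣+∣q∣ p q (drop-∷-Empty d)

∣p∩q∣+∣∁p∩q∣≡∣q∣ : ∀ (p q : Subset m) → ∣ p ∩ q ∣ + ∣ ∁ p ∩ q ∣ ≡ ∣ q ∣
∣p∩q∣+∣∁p∩q∣≡∣q∣ []            []            = refl
∣p∩q∣+∣∁p∩q∣≡∣q∣ (inside ∷ p)  (inside ∷ q)  = cong suc (∣p∩q∣+∣∁p∩q∣≡∣q∣ p q)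
∣p∩q∣+∣∁p∩q∣≡∣q∣ (outside ∷ p) (inside ∷ q)  =
  trans (+-suc ∣ p ∩ q ∣ ∣ ∁ p ∩ q ∣) (cong suc (∣p∩q∣+∣∁p∩q∣≡∣q∣ p q))
∣p∩q∣+∣∁p∩q∣≡∣q∣ (inside ∷ p)  (outside ∷ q) = ∣p∩q∣+∣∁p∩q∣≡∣q∣ p q
∣p∩q∣+∣∁p∩q∣≡∣q∣ (outside ∷ p) (outside ∷ q) = ∣p∩q∣+∣∁p∩q∣≡∣q∣ p q

x∉p-x : ∀ (p : Subset m) x → x ∉ p - x
x∉p-x (_ ∷ p) zero    ()
x∉p-x (_ ∷ p) (suc x) x∈ = x∉p-x p x (drop-there x∈)

x∈p⇒∣p∣≡1+∣p-x∣ : ∀ (p : Subset m) {x} → x ∈ˢ p → ∣ p ∣ ≡ suc ∣ p - x ∣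
x∈p⇒∣p∣≡1+∣p-x∣ (inside ∷ p)  {zero}  _  = cong suc (sym (cong ∣_∣ (p─⊥≡p p)))
x∈p⇒∣p∣≡1+∣p-x∣ (inside ∷ p)  {suc x} x∈ = cong suc (x∈p⇒∣p∣≡1+∣p-x∣ p (drop-there x∈))
x∈p⇒∣p∣≡1+∣p-x∣ (outside ∷ p) {suc x} x∈ = x∈p⇒∣p∣≡1+∣p-x∣ p (drop-there x∈)

∣p∣≡1⇒x≡y : ∀ {p : Subset m} {x y} → ∣ p ∣ ≡ 1 → x ∈ˢ p → y ∈ˢ p → x ≡ y
∣p∣≡1⇒x≡y {p = p} {x} {y} ∣p∣≡1 x∈p y∈p with x ≟ y
... | yes x≡y = x≡y
... | no  x≢y = ⊥-elim (0≢1+n (trans ∣p-x∣≡0 ∣p-x∣≡1+∣p-x-y∣))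
  where
  ∣p-x∣≡0 : 0 ≡ ∣ p - x ∣
  ∣p-x∣≡0 = suc-injective (trans (sym ∣p∣≡1) (x∈p⇒∣p∣≡1+∣p-x∣ p x∈p))
  ∣p-x∣≡1+∣p-x-y∣ : ∣ p - x ∣ ≡ suc ∣ p - x - y ∣
  ∣p-x∣≡1+∣p-x-y∣ = x∈p⇒∣p∣≡1+∣p-x∣ (p - x) (x∈p∧x≢y⇒x∈p-y y∈p (λ y≡x → x≢y (sym y≡x)))

⊆⁅x⁆⇒∣p∣≡1 : ∀ {p : Subset m} {x} → x ∈ˢ p → p ⊆ ⁅ x ⁆ → ∣ p ∣ ≡ 1
⊆⁅x⁆⇒∣p∣≡1 {p = p} {x} x∈p p⊆⁅x⁆ =
  trans (cong ∣_∣ (⊆-antisym p⊆⁅x⁆ ⁅x⁆⊆p)) (∣⁅x⁆∣≡1 x)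
  where
  ⁅x⁆⊆p : ⁅ x ⁆ ⊆ p
  ⁅x⁆⊆p y∈⁅x⁆ = subst (_∈ˢ p) (sym (x∈⁅y⁆⇒x≡y x y∈⁅x⁆)) x∈p

p-x∩q≡p∩q : ∀ (p q : Subset m) {x} → x ∉ q → (p - x) ∩ q ≡ p ∩ q
p-x∩q≡p∩q p q {x} x∉q = ⊆-antisym ⊆-drop ⊆-keep
  where
  ⊆-drop : (p - x) ∩ q ⊆ p ∩ q
  ⊆-drop y∈ = let (y∈p-x , y∈q) = x∈p∩q⁻ (p - x) q y∈ in x∈p∩q⁺ (p─q⊆p p ⁅ x ⁆ y∈p-x , y∈q)
  ⊆-keep : p ∩ q ⊆ (p - x) ∩ q
  ⊆-keep y∈ = let (y∈p , y∈q) = x∈p∩q⁻ p q y∈ in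
    x∈p∩q⁺ (x∈p∧x≢y⇒x∈p-y y∈p (λ y≡x → x∉q (subst (_∈ˢ q) y≡x y∈q)) , y∈q)

x∈⋃⁺ : ∀ {ps : List (Subset m)} {p x} → p ∈ ps → x ∈ˢ p → x ∈ˢ ⋃ ps
x∈⋃⁺ (here refl) x∈p = x∈p∪q⁺ (inj₁ x∈p)
x∈⋃⁺ (there p∈)  x∈p = x∈p∪q⁺ (inj₂ (x∈⋃⁺ p∈ x∈p))

x∈⋃⁻ : ∀ (ps : List (Subset m)) {x} → x ∈ˢ ⋃ ps → Any (x ∈ˢ_) ps
x∈⋃⁻ []       x∈ = ⊥-elim (∉⊥ x∈)
x∈⋃⁻ (p ∷ ps) x∈ with x∈p∪q⁻ p (⋃ ps) x∈
... | inj₁ x∈p = here x∈p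
... | inj₂ x∈⋃ = there (x∈⋃⁻ ps x∈⋃)

Disjoint-mono : ∀ {p q p′ q′ : Subset m} → p′ ⊆ p → q′ ⊆ q → Disjoint p q → Disjoint p′ q′
Disjoint-mono {p′ = p′} {q′} p′⊆p q′⊆q p#q (y , y∈) =
  let (y∈p′ , y∈q′) = x∈p∩q⁻ p′ q′ y∈ in p#q (y , x∈p∩q⁺ (p′⊆p y∈p′ , q′⊆q y∈q′))

Disjoint-⋃ : ∀ {p : Subset m} (qs : List (Subset m)) → All (Disjoint p) qs → Disjoint p (⋃ qs)
Disjoint-⋃ {p = p} qs p#qs (y , y∈) =
  let (y∈p , y∈⋃) = x∈p∩q⁻ p (⋃ qs) y∈
      (p#q , y∈q) = All.lookupAny p#qs (x∈⋃⁻ qs y∈⋃)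
  in p#q (y , x∈p∩q⁺ (y∈p , y∈q))

∣⋃ps∩r∣≡length*k : ∀ {k} (ps : List (Subset m)) (r : Subset m) → AllPairs Disjoint ps →
                   All (λ p → ∣ p ∩ r ∣ ≡ k) ps → ∣ ⋃ ps ∩ r ∣ ≡ length ps * k
∣⋃ps∩r∣≡length*k {m} []       r _ _ = trans (cong ∣_∣ (∩-zeroˡ r)) (∣⊥∣≡0 m)
∣⋃ps∩r∣≡length*k {k = k} (p ∷ ps) r (p#ps ∷ ps-disjoint) (∣p∩r∣≡k ∷ sizes) = begin
  ∣ (p ∪ ⋃ ps) ∩ r ∣         ≡⟨ cong ∣_∣ (∩-distribʳ-∪ r p (⋃ ps)) ⟩
  ∣ p ∩ r ∪ ⋃ ps ∩ r ∣       ≡⟨ ∣p∪q∣≡∣p∣+∣q∣ (p ∩ r) (⋃ ps ∩ r) pieces-disjoint ⟩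
  ∣ p ∩ r ∣ + ∣ ⋃ ps ∩ r ∣   ≡⟨ cong₂ _+_ ∣p∩r∣≡k (∣⋃ps∩r∣≡length*k ps r ps-disjoint sizes) ⟩
  k + length ps * k          ∎
  where
  open ≡-Reasoning
  pieces-disjoint : Disjoint (p ∩ r) (⋃ ps ∩ r)
  pieces-disjoint = Disjoint-mono (p∩q⊆p p r) (p∩q⊆p (⋃ ps) r) (Disjoint-⋃ ps p#ps)

unique⇒allPairs : ∀ {A : Set} {R : A → A → Set} {xs : List A} → Unique xs →
                  (∀ {a b} → a ∈ xs → b ∈ xs → a ≢ b → R a b) → AllPairs R xs
unique⇒allPairs []          _ = []
unique⇒allPairs (a≢xs ∷ u) r =
  All.tabulate (λ b∈ → r (here refl) (there b∈) (All.lookup a≢xs b∈))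
  ∷ unique⇒allPairs u (λ a∈ b∈ → r (there a∈) (there b∈))

numPoints∸n*n≡1+n : ∀ n → numPoints n ∸ n * n ≡ suc n
numPoints∸n*n≡1+n n = begin
  n * n + n + 1 ∸ n * n     ≡⟨ cong (_∸ n * n) (+-assoc (n * n) n 1) ⟩
  n * n + (n + 1) ∸ n * n   ≡⟨ m+n∸m≡n (n * n) (n + 1) ⟩
  n + 1                     ≡⟨ +-comm n 1 ⟩
  suc n                     ∎
  where open ≡-Reasoning

module Pencil {n : ℕ} (P : PurePartialPlane n) (x : Point n) where

  pencil : List (Line n)
  pencil = filter (x ∈?_) (lines P)

  spokes : List (Line n)
  spokes = map (_- x) pencil

  covered : Line n
  covered = ⋃ spokes

  transversal : Line n
  transversal = ∁ covered

  ∈-pencil⁻ : ∀ {K} → K ∈ pencil → K ∈ lines P × x ∈ˢ K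
  ∈-pencil⁻ = ∈-filter⁻ (x ∈?_)

  pencil-concurrent : ∀ {K K′ y} → K ∈ pencil → K′ ∈ pencil → K ≢ K′ →
                      y ∈ˢ K → y ∈ˢ K′ → y ≡ x
  pencil-concurrent K∈ K′∈ K≢K′ y∈K y∈K′ =
    let (K∈P , x∈K) = ∈-pencil⁻ K∈
        (K′∈P , x∈K′) = ∈-pencil⁻ K′∈
    in ∣p∣≡1⇒x≡y (meetOnce P K∈P K′∈P K≢K′) (x∈p∩q⁺ (y∈K , y∈K′)) (x∈p∩q⁺ (x∈K , x∈K′))

  spokes-disjoint : AllPairs Disjoint spokes
  spokes-disjoint =
    AllPairsₚ.map⁺ (unique⇒allPairs (Uniqueₚ.filter⁺ (x ∈?_) (distinct P)) disjoint)
    where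
    disjoint : ∀ {K K′} → K ∈ pencil → K′ ∈ pencil → K ≢ K′ → Disjoint (K - x) (K′ - x)
    disjoint {K} {K′} K∈ K′∈ K≢K′ (y , y∈) =
      let (y∈K-x , y∈K′-x) = x∈p∩q⁻ (K - x) (K′ - x) y∈
          y≡x = pencil-concurrent K∈ K′∈ K≢K′ (p─q⊆p K ⁅ x ⁆ y∈K-x) (p─q⊆p K′ ⁅ x ⁆ y∈K′-x)
      in x∉p-x K x (subst (_∈ˢ K - x) y≡x y∈K-x)

  x∉covered : x ∉ covered
  x∉covered x∈ =
    let (K , x∈K-x) = Any.satisfied (Anyₚ.map⁻ (x∈⋃⁻ spokes x∈)) in x∉p-x K x x∈K-x

  ∣covered∩r∣≡degree*k : ∀ {k} (r : Subset (numPoints n)) →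
                         (∀ {K} → K ∈ pencil → ∣ (K - x) ∩ r ∣ ≡ k) →
                         ∣ covered ∩ r ∣ ≡ degree P x * k
  ∣covered∩r∣≡degree*k {k} r sizes =
    trans (∣⋃ps∩r∣≡length*k spokes r spokes-disjoint (Allₚ.map⁺ (All.tabulate sizes)))
          (cong (_* k) (length-map (_- x) pencil))

  ∣covered∣≡degree*n : ∣ covered ∣ ≡ degree P x * n
  ∣covered∣≡degree*n =
    trans (cong ∣_∣ (sym (∩-identityʳ covered))) (∣covered∩r∣≡degree*k ⊤ ∣K-x∩⊤∣≡n)
    where
    ∣K-x∩⊤∣≡n : ∀ {K} → K ∈ pencil → ∣ (K - x) ∩ ⊤ ∣ ≡ n
    ∣K-x∩⊤∣≡n {K} K∈ =
      let (K∈P , x∈K) = ∈-pencil⁻ K∈ in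
      trans (cong ∣_∣ (∩-identityʳ (K - x)))
            (suc-injective (trans (sym (x∈p⇒∣p∣≡1+∣p-x∣ K x∈K)) (All.lookup (lineSize P) K∈P)))

  ∣covered∩L∣≡degree : ∀ {L} → L ∈ lines P → x ∉ L → ∣ covered ∩ L ∣ ≡ degree P x
  ∣covered∩L∣≡degree {L} L∈P x∉L =
    trans (∣covered∩r∣≡degree*k L ∣K-x∩L∣≡1) (*-identityʳ (degree P x))
    where
    ∣K-x∩L∣≡1 : ∀ {K} → K ∈ pencil → ∣ (K - x) ∩ L ∣ ≡ 1
    ∣K-x∩L∣≡1 {K} K∈ =
      let (K∈P , x∈K) = ∈-pencil⁻ K∈ in
      trans (cong ∣_∣ (p-x∩q≡p∩q K L x∉L))
            (meetOnce P K∈P L∈P (λ K≡L → x∉L (subst (x ∈ˢ_) K≡L x∈K)))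

  x∈transversal : x ∈ˢ transversal
  x∈transversal = x∉p⇒x∈∁p x∉covered

  ∣transversal∣≡1+n : degree P x ≡ n → ∣ transversal ∣ ≡ suc n
  ∣transversal∣≡1+n deg = begin
    ∣ ∁ covered ∣                 ≡⟨ ∣∁p∣≡n∸∣p∣ covered ⟩
    numPoints n ∸ ∣ covered ∣     ≡⟨ cong (numPoints n ∸_) ∣covered∣≡degree*n ⟩
    numPoints n ∸ degree P x * n  ≡⟨ cong (λ d → numPoints n ∸ d * n) deg ⟩
    numPoints n ∸ n * n           ≡⟨ numPoints∸n*n≡1+n n ⟩
    suc n                         ∎
    where open ≡-Reasoning

  transversal-meets-line-through : ∀ {L} → L ∈ lines P → x ∈ˢ L → ∣ transversal ∩ L ∣ ≡ 1
  transversal-meets-line-through {L} L∈P x∈L =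
    ⊆⁅x⁆⇒∣p∣≡1 (x∈p∩q⁺ (x∈transversal , x∈L)) only-x
    where
    only-x : transversal ∩ L ⊆ ⁅ x ⁆
    only-x {y} y∈ with y ≟ x
    ... | yes refl = x∈⁅x⁆ x
    ... | no  y≢x  =
      let (y∈transversal , y∈L) = x∈p∩q⁻ transversal L y∈
          L-x∈spokes = ∈-map⁺ (_- x) (∈-filter⁺ (x ∈?_) L∈P x∈L)
      in ⊥-elim (x∈∁p⇒x∉p y∈transversal (x∈⋃⁺ L-x∈spokes (x∈p∧x≢y⇒x∈p-y y∈L y≢x)))

  transversal-meets-line-avoiding : degree P x ≡ n → ∀ {L} → L ∈ lines P → x ∉ L →
                                    ∣ transversal ∩ L ∣ ≡ 1
  transversal-meets-line-avoiding deg {L} L∈P x∉L = +-cancelˡ-≡ n _ _ (begin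
    n + ∣ transversal ∩ L ∣             ≡⟨ cong (_+ ∣ transversal ∩ L ∣) (sym (trans (∣covered∩L∣≡degree L∈P x∉L) deg)) ⟩
    ∣ covered ∩ L ∣ + ∣ ∁ covered ∩ L ∣ ≡⟨ ∣p∩q∣+∣∁p∩q∣≡∣q∣ covered L ⟩
    ∣ L ∣                               ≡⟨ All.lookup (lineSize P) L∈P ⟩
    suc n                               ≡⟨ +-comm 1 n ⟩
    n + 1                               ∎)
    where open ≡-Reasoning

  transversal-meets-once : degree P x ≡ n → ∀ {L} → L ∈ lines P → ∣ transversal ∩ L ∣ ≡ 1
  transversal-meets-once deg {L} L∈P with x ∈? L
  ... | yes x∈L = transversal-meets-line-through L∈P x∈L
  ... | no  x∉L = transversal-meets-line-avoiding deg L∈P x∉L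

lemma1 : ∀ (n : ℕ) (P : PurePartialPlane n) → Saturated P →
           ∀ (x : Point n) → degree P x ≢ n
lemma1 n P saturated x deg = ¬Fin0 (subst Fin (trans deg n≡0) (Any.index transversal∈pencil))
  where
  open Pencil P x
  transversal∈P : transversal ∈ lines P
  transversal∈P = saturated transversal (∣transversal∣≡1+n deg) (transversal-meets-once deg)
  transversal∈pencil : transversal ∈ pencil
  transversal∈pencil = ∈-filter⁺ (x ∈?_) transversal∈P x∈transversal
  n≡0 : n ≡ 0
  n≡0 = suc-injective (begin
    suc n                         ≡⟨ sym (∣transversal∣≡1+n deg) ⟩
    ∣ transversal ∣               ≡⟨ cong ∣_∣ (sym (∩-idem transversal)) ⟩
    ∣ transversal ∩ transversal ∣ ≡⟨ transversal-meets-line-through transversal∈P x∈transversal ⟩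
    1                             ∎)
    where open ≡-Reasoning
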